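{- Let $\lambda$ be a nonzero real number. For every integer $n \geq 0$, \[ b_{n+1,\lambda}(x)-x\,b_{n,\lambda}(x-\lambda)+b_{n,\lambda}(x-\lambda)=2\sum_{k=0}^n\sum_{m=0}^k\sum_{l=0}^m\binom{n}{k}\binom{m}{l}\lambda^{k-m+l}S_1(k,m)\,b_{n-k,\lambda}\,(-1)^l\,b_{m-l}(x). \]
   Context: For a nonzero real $\lambda$, the degenerate ordered Bell polynomials $b_{n,\lambda}(x)$ are defined by the formal power series identity \[ \frac{1}{2-(1+\lambda t)^{1/\lambda}}(1+\lambda t)^{x/\lambda}=\sum_{n=0}^\infty b_{n,\lambda}(x)\frac{t^n}{n!}, \] where $(1+\lambda t)^{a/\lambda}=\exp\big(\tfrac{a}{\lambda}\log(1+\lambda t)\big)$, and $b_{n,\lambda}=b_{n,\lambda}(0)$. The ordered Bell polynomials $b_n(x)$ are defined by $\frac{1}{2-e^t}e^{xt}=\sum_{n\ge 0}b_n(x)\frac{t^n}{n!}$. The (signed) Stirling numbers of the first kind $S_1(n,l)$ are defined by $x(x-1)\cdots(x-n+1)=\sum_{l=0}^n S_1(n,l)x^l$. -}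

module Defs where

open import Level using (Level)
open import Data.Nat as ℕ using (ℕ; zero; suc; _∸_; _≤?_)
open import Data.Nat.Combinatorics using (_C_)
open import Relation.Nullary using (yes; no)
open import Algebra.Bundles using (CommutativeRing)

module _ {c ℓ : Level} (R : CommutativeRing c ℓ) where
  open CommutativeRing R

  _·_ : ℕ → Carrier → Carrier
  zero  · a = 0#
  suc n · a = a + n · a

  _^_ : Carrier → ℕ → Carrier
  a ^ zero  = 1#
  a ^ suc n = a * (a ^ n)

  sgn : ℕ → Carrier
  sgn zero    = 1#
  sgn (suc n) = - sgn n

  Σ≤ : ℕ → (ℕ → Carrier) → Carrier
  Σ≤ zero    f = f 0
  Σ≤ (suc n) f = Σ≤ n f + f (suc n)

  -- degenerate falling factorial (x)_{n,λ} = x (x-λ) ... (x-(n-1)λ);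
  -- (1+λt)^{x/λ} = Σ_n (x)_{n,λ} t^n/n!
  dfall : Carrier → Carrier → ℕ → Carrier
  dfall λ' x zero    = 1#
  dfall λ' x (suc n) = dfall λ' x n * (x - n · λ')

  -- Given the EGF coefficients e_n of a series E(t) with e_0 = 1, the EGF
  -- coefficients of 1/(2 - E(t)).  Coefficient comparison in
  -- F(t)(2 - E(t)) = 1 gives f_0 = 1 and
  -- f_{n+1} = Σ_{j=0}^{n} C(n+1,j) e_{n+1-j} f_j .
  -- egfInvTable n i = f_i for i ≤ n.
  egfInvTable : (ℕ → Carrier) → ℕ → ℕ → Carrier
  egfInvTable e zero    i = 1#
  egfInvTable e (suc n) i with i ≤? n
  ... | yes _ = egfInvTable e n i
  ... | no  _ = Σ≤ n (λ j → ((suc n) C j) · (e (suc n ∸ j) * egfInvTable e n j))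

  egfInv : (ℕ → Carrier) → ℕ → Carrier
  egfInv e n = egfInvTable e n n

  -- degenerate ordered Bell numbers b_{n,λ}:  1/(2-(1+λt)^{1/λ}) = Σ b_{n,λ} t^n/n!
  degBell : Carrier → ℕ → Carrier
  degBell λ' = egfInv (dfall λ' 1#)

  -- degenerate ordered Bell polynomials b_{n,λ}(x):
  -- EGF product of 1/(2-(1+λt)^{1/λ}) and (1+λt)^{x/λ}
  degBellPoly : Carrier → ℕ → Carrier → Carrier
  degBellPoly λ' n x = Σ≤ n (λ k → (n C k) · (degBell λ' k * dfall λ' x (n ∸ k)))

  -- ordered Bell numbers b_n:  1/(2-e^t) = Σ b_n t^n/n!
  ordBell : ℕ → Carrier
  ordBell = egfInv (λ _ → 1#)

  -- ordered Bell polynomials b_n(x): EGF product of 1/(2-e^t) and e^{xt}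
  ordBellPoly : ℕ → Carrier → Carrier
  ordBellPoly n x = Σ≤ n (λ k → (n C k) · (ordBell k * (x ^ (n ∸ k))))

  -- signed Stirling numbers of the first kind:
  -- x(x-1)...(x-n+1) = Σ_l S₁ n l x^l
  S₁ : ℕ → ℕ → Carrier
  S₁ zero    zero    = 1#
  S₁ zero    (suc l) = 0#
  S₁ (suc n) zero    = 0#
  S₁ (suc n) (suc l) = S₁ n l - n · S₁ n (suc l)

-- Write E_y(t) = (1 + λt)^{y/λ} and B_x = E_x/(2 - E_1). Since E_y' = y E_{y-λ},
-- (1/(2 - E_1))' = E_1'/(2 - E_1)², E_{1-λ} E_x = E_1 E_{x-λ} and E_1/(2 - E_1) = 2/(2 - E_1) - 1,
-- one gets B_x' - x B_{x-λ} + B_{x-λ} = 2 B_{x-λ}/(2 - E_1), which is the left-hand side.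
-- On the right, the substitution t ↦ log(1 + λt)/λ is a ring homomorphism of power series taking
-- e^{yt} to E_y, hence 1/(2 - e^t) to 1/(2 - E_1) and e^{-λt} e^{xt}/(2 - e^t) to B_{x-λ}; on
-- coefficients it is the λ-weighted Stirling transform, which produces the triple sum.
-- It is multiplicative because it turns d/dt into (1 + λt) d/dt, a derivation, so induction applies.
-- Power series are handled through their exponential coefficient sequences, where products are
-- binomial convolutions and d/dt is the shift, so everything holds over any commutative ring.
module Submission where

open import Defs
open import Level using (Level)
open import Data.Nat using (ℕ; suc; _∸_) renaming (_+_ to _+ℕ_; _*_ to _*ℕ_)
open import Data.Nat.Combinatorics using (_C_)
open import Relation.Nullary using (¬_)
open import Algebra.Bundles using (CommutativeRing)

open import Data.Nat using (zero; _≤_; _<_; z≤n; s≤s; s≤s⁻¹; _≤?_)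
import Data.Nat.Properties as ℕ
open import Data.Nat.Properties
  using (≤-refl; m≤n⇒m≤1+n; m<n⇒m<1+n; n<1+n; 1+n≰n; m≤n⇒m<n∨m≡n; +-∸-assoc; m+[n∸m]≡n; n∸n≡0)
open import Data.Nat.Combinatorics using (nCk+nC[k+1]≡[n+1]C[k+1]; k>n⇒nCk≡0; nCn≡1)
open import Data.Product using (_,_)
open import Data.Sum using (inj₁; inj₂)
open import Data.Empty using (⊥-elim)
open import Relation.Nullary using (yes; no)
open import Relation.Binary.PropositionalEquality as ≡ using (_≡_)
import Relation.Binary.Reasoning.Setoid as SetoidReasoning
import Algebra.Construct.Pointwise as Pointwise
import Algebra.Properties.Ring as RingProperties
import Algebra.Solver.Ring.NaturalCoefficients.Default as NatSolver

module _ {c ℓ : Level} (R : CommutativeRing c ℓ) where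
  open CommutativeRing R
  open import Algebra.Properties.Semiring.Mult semiring
    using (_×_; ×-congʳ; ×-homo-+; ×-assocˡ; ×-comm-*)
  open import Algebra.Properties.CommutativeMonoid.Mult +-commutativeMonoid
    using (×-distrib-+)
  open import Algebra.Properties.CommutativeSemigroup +-commutativeSemigroup
    using (interchange; x∙yz≈y∙xz; xy∙z≈xz∙y; xy∙z≈x∙zy)
  open import Algebra.Properties.CommutativeSemigroup *-commutativeSemigroup
    using () renaming (x∙yz≈y∙xz to *-x∙yz≈y∙xz)
  open RingProperties ring
    using (-0#≈0#; -‿+-comm; -‿distribˡ-*; x[y-z]≈xy-xz; +-cancelʳ; //-rightDividesˡ; //-rightDividesʳ)

  module _ where
    open SetoidReasoning setoid

    infixr 8 _•_
    _•_ : ℕ → Carrier → Carrier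
    _•_ = _·_ R

    •≈× : ∀ n a → n • a ≈ n × a
    •≈× zero    a = refl
    •≈× (suc n) a = +-congˡ (•≈× n a)

    •-congʳ : ∀ n {a b} → a ≈ b → n • a ≈ n • b
    •-congʳ n {a} {b} a≈b = begin
      n • a  ≈⟨ •≈× n a ⟩
      n × a  ≈⟨ ×-congʳ n a≈b ⟩
      n × b  ≈⟨ •≈× n b ⟨
      n • b  ∎

    •-distrib-+ : ∀ n a b → n • (a + b) ≈ n • a + n • b
    •-distrib-+ n a b = begin
      n • (a + b)      ≈⟨ •≈× n _ ⟩
      n × (a + b)      ≈⟨ ×-distrib-+ a b n ⟩
      n × a + n × b    ≈⟨ +-cong (•≈× n a) (•≈× n b) ⟨
      n • a + n • b    ∎

    •-homo-+ : ∀ m n a → (m +ℕ n) • a ≈ m • a + n • a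
    •-homo-+ m n a = begin
      (m +ℕ n) • a     ≈⟨ •≈× (m +ℕ n) a ⟩
      (m +ℕ n) × a     ≈⟨ ×-homo-+ a m n ⟩
      m × a + n × a    ≈⟨ +-cong (•≈× m a) (•≈× n a) ⟨
      m • a + n • a    ∎

    •-assoc : ∀ m n a → (m *ℕ n) • a ≈ m • (n • a)
    •-assoc m n a = begin
      (m *ℕ n) • a     ≈⟨ •≈× (m *ℕ n) a ⟩
      (m *ℕ n) × a     ≈⟨ ×-assocˡ a m n ⟨
      m × (n × a)      ≈⟨ ×-congʳ m (•≈× n a) ⟨
      m × (n • a)      ≈⟨ •≈× m _ ⟨
      m • (n • a)      ∎

    •-comm : ∀ m n a → m • (n • a) ≈ n • (m • a)
    •-comm m n a = begin
      m • (n • a)   ≈⟨ •-assoc m n a ⟨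
      (m *ℕ n) • a  ≡⟨ ≡.cong (_• a) (ℕ.*-comm m n) ⟩
      (n *ℕ m) • a  ≈⟨ •-assoc n m a ⟩
      n • (m • a)   ∎

    *-•-comm : ∀ n r a → r * (n • a) ≈ n • (r * a)
    *-•-comm n r a = begin
      r * (n • a)      ≈⟨ *-congˡ (•≈× n a) ⟩
      r * (n × a)      ≈⟨ ×-comm-* n r a ⟩
      n × (r * a)      ≈⟨ •≈× n _ ⟨
      n • (r * a)      ∎

    •-*-assoc : ∀ n a r → (n • a) * r ≈ n • (a * r)
    •-*-assoc n a r = trans (*-comm _ r) (trans (*-•-comm n r a) (•-congʳ n (*-comm r a)))

    •-inward : ∀ n p s a → n • ((p * s) * a) ≈ (p * (n • s)) * a
    •-inward n p s a = begin
      n • ((p * s) * a)   ≈⟨ •-*-assoc n (p * s) a ⟨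
      (n • (p * s)) * a   ≈⟨ *-congʳ (*-•-comm n p s) ⟨
      (p * (n • s)) * a   ∎

    •-zeroʳ : ∀ n → n • 0# ≈ 0#
    •-zeroʳ zero    = refl
    •-zeroʳ (suc n) = trans (+-identityˡ _) (•-zeroʳ n)

    ∑ : ℕ → (ℕ → Carrier) → Carrier
    ∑ = Σ≤ R

    ∑-cong : ∀ n {f g : ℕ → Carrier} → (∀ i → i ≤ n → f i ≈ g i) → ∑ n f ≈ ∑ n g
    ∑-cong zero    f≈g = f≈g 0 z≤n
    ∑-cong (suc n) f≈g = +-cong (∑-cong n (λ i i≤n → f≈g i (m≤n⇒m≤1+n i≤n))) (f≈g (suc n) ≤-refl)

    ∑-zero : ∀ n → ∑ n (λ _ → 0#) ≈ 0#
    ∑-zero zero    = refl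
    ∑-zero (suc n) = trans (+-congʳ (∑-zero n)) (+-identityʳ 0#)

    ∑-distrib-+ : ∀ n (f g : ℕ → Carrier) → ∑ n (λ i → f i + g i) ≈ ∑ n f + ∑ n g
    ∑-distrib-+ zero    f g = refl
    ∑-distrib-+ (suc n) f g = trans (+-congʳ (∑-distrib-+ n f g)) (interchange _ _ _ _)

    *-distribˡ-∑ : ∀ r n (f : ℕ → Carrier) → r * ∑ n f ≈ ∑ n (λ i → r * f i)
    *-distribˡ-∑ r zero    f = refl
    *-distribˡ-∑ r (suc n) f = trans (distribˡ r _ _) (+-congʳ (*-distribˡ-∑ r n f))

    *-distribʳ-∑ : ∀ r n (f : ℕ → Carrier) → ∑ n f * r ≈ ∑ n (λ i → f i * r)
    *-distribʳ-∑ r zero    f = refl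
    *-distribʳ-∑ r (suc n) f = trans (distribʳ r _ _) (+-congʳ (*-distribʳ-∑ r n f))

    •-distrib-∑ : ∀ m n (f : ℕ → Carrier) → m • ∑ n f ≈ ∑ n (λ i → m • f i)
    •-distrib-∑ m zero    f = refl
    •-distrib-∑ m (suc n) f = trans (•-distrib-+ m _ _) (+-congʳ (•-distrib-∑ m n f))

    ∑-shift : ∀ n (f : ℕ → Carrier) → ∑ (suc n) f ≈ f 0 + ∑ n (λ i → f (suc i))
    ∑-shift zero    f = refl
    ∑-shift (suc n) f = trans (+-congʳ (∑-shift n f)) (+-assoc _ _ _)

    ∑-shift-vanishing : ∀ n (f : ℕ → Carrier) → f (suc n) ≈ 0# → ∑ n f ≈ f 0 + ∑ n (λ i → f (suc i))
    ∑-shift-vanishing n f fₙ₊₁≈0 = trans (sym (trans (+-congˡ fₙ₊₁≈0) (+-identityʳ _))) (∑-shift n f)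

  -- Exponential generating functions

  Seq : Set c
  Seq = ℕ → Carrier

  infix 4 _≋_
  _≋_ : Seq → Seq → Set ℓ
  a ≋ b = ∀ n → a n ≈ b n

  infixl 6 _⊞_
  _⊞_ : Seq → Seq → Seq
  (a ⊞ b) n = a n + b n

  𝟘 : Seq
  𝟘 _ = 0#

  infixr 7 _⊙_
  _⊙_ : Carrier → Seq → Seq
  (r ⊙ a) n = r * a n

  infixl 7 _⋆_
  _⋆_ : Seq → Seq → Seq
  (a ⋆ b) n = ∑ n (λ k → (n C k) • (a k * b (n ∸ k)))

  ι : Carrier → Seq
  ι r zero    = r
  ι r (suc n) = 0#

  δ : Seq
  δ = ι 1#

  ∂ : Seq → Seq
  ∂ a n = a (suc n)

  euler : Seq → Seq
  euler a n = n • a n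

  -- (1 + r t) d/dt
  ∂[_] : Carrier → Seq → Seq
  ∂[ r ] a = ∂ a ⊞ r ⊙ euler a

  module _ where
    open SetoidReasoning setoid

    ⋆-cong : ∀ {a a′ b b′} → a ≋ a′ → b ≋ b′ → a ⋆ b ≋ a′ ⋆ b′
    ⋆-cong a≋a′ b≋b′ n = ∑-cong n (λ k _ → •-congʳ (n C k) (*-cong (a≋a′ k) (b≋b′ (n ∸ k))))

    ⋆-distribˡ-⊞ : ∀ a b c → a ⋆ (b ⊞ c) ≋ a ⋆ b ⊞ a ⋆ c
    ⋆-distribˡ-⊞ a b c n = trans
      (∑-cong n (λ k _ → trans (•-congʳ (n C k) (distribˡ (a k) _ _)) (•-distrib-+ (n C k) _ _)))
      (∑-distrib-+ n _ _)

    ⋆-distribʳ-⊞ : ∀ a b c → (b ⊞ c) ⋆ a ≋ b ⋆ a ⊞ c ⋆ a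
    ⋆-distribʳ-⊞ a b c n = trans
      (∑-cong n (λ k _ → trans (•-congʳ (n C k) (distribʳ (a (n ∸ k)) _ _)) (•-distrib-+ (n C k) _ _)))
      (∑-distrib-+ n _ _)

    ⋆-∂ʳ : ∀ a b n → (a ⋆ ∂ b) n ≈ (n C 0) • (a 0 * b (suc n)) + ∑ n (λ i → (n C suc i) • (a (suc i) * b (n ∸ i)))
    ⋆-∂ʳ a b n = begin
      ∑ n (λ j → (n C j) • (a j * b (suc (n ∸ j))))
        ≈⟨ ∑-cong n (λ j j≤n → •-congʳ (n C j) (*-congˡ (reflexive (≡.cong b (+-∸-assoc 1 j≤n))))) ⟨
      ∑ n f
        ≈⟨ ∑-shift-vanishing n f (reflexive (≡.cong (_• (a (suc n) * b (n ∸ n))) (k>n⇒nCk≡0 (n<1+n n)))) ⟩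
      f 0 + ∑ n (λ i → f (suc i))
        ∎
      where
      f : ℕ → Carrier
      f j = (n C j) • (a j * b (suc n ∸ j))

    ∂-⋆ : ∀ a b → ∂ (a ⋆ b) ≋ ∂ a ⋆ b ⊞ a ⋆ ∂ b
    ∂-⋆ a b n = begin
      ∑ (suc n) (λ k → (suc n C k) • (a k * b (suc n ∸ k)))
        ≈⟨ ∑-shift n _ ⟩
      head + ∑ n (λ i → (suc n C suc i) • X i)
        ≈⟨ +-congˡ (∑-cong n (λ i _ → pascal i)) ⟩
      head + ∑ n (λ i → (n C i) • X i + (n C suc i) • X i)
        ≈⟨ +-congˡ (∑-distrib-+ n _ _) ⟩
      head + ((∂ a ⋆ b) n + ∑ n (λ i → (n C suc i) • X i))
        ≈⟨ x∙yz≈y∙xz _ _ _ ⟩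
      (∂ a ⋆ b) n + (head + ∑ n (λ i → (n C suc i) • X i))
        ≈⟨ +-congˡ (⋆-∂ʳ a b n) ⟨
      (∂ a ⋆ b) n + (a ⋆ ∂ b) n
        ∎
      where
      head : Carrier
      head = (n C 0) • (a 0 * b (suc n))
      X : ℕ → Carrier
      X i = a (suc i) * b (n ∸ i)
      pascal : ∀ i → (suc n C suc i) • X i ≈ (n C i) • X i + (n C suc i) • X i
      pascal i = trans (reflexive (≡.cong (_• X i) (≡.sym (nCk+nC[k+1]≡[n+1]C[k+1] n i))))
                       (•-homo-+ (n C i) (n C suc i) (X i))

    ⋆-zeroˡ : ∀ a → 𝟘 ⋆ a ≋ 𝟘
    ⋆-zeroˡ a zero    = trans (+-identityʳ _) (zeroˡ (a 0))
    ⋆-zeroˡ a (suc n) = trans (∂-⋆ 𝟘 a n) (trans (+-cong (⋆-zeroˡ a n) (⋆-zeroˡ (∂ a) n)) (+-identityʳ 0#))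

    ι-⋆ : ∀ r a → ι r ⋆ a ≋ r ⊙ a
    ι-⋆ r a zero    = +-identityʳ _
    ι-⋆ r a (suc n) = trans (∂-⋆ (ι r) a n) (trans (+-cong (⋆-zeroˡ a n) (ι-⋆ r (∂ a) n)) (+-identityˡ _))

    ⋆-comm : ∀ a b → a ⋆ b ≋ b ⋆ a
    ⋆-comm a b zero    = +-congʳ (*-comm (a 0) (b 0))
    ⋆-comm a b (suc n) = begin
      ∂ (a ⋆ b) n                  ≈⟨ ∂-⋆ a b n ⟩
      (∂ a ⋆ b) n + (a ⋆ ∂ b) n    ≈⟨ +-cong (⋆-comm (∂ a) b n) (⋆-comm a (∂ b) n) ⟩
      (b ⋆ ∂ a) n + (∂ b ⋆ a) n    ≈⟨ +-comm _ _ ⟩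
      (∂ b ⋆ a) n + (b ⋆ ∂ a) n    ≈⟨ ∂-⋆ b a n ⟨
      ∂ (b ⋆ a) n                  ∎

    ⋆-identityˡ : ∀ a → δ ⋆ a ≋ a
    ⋆-identityˡ a n = trans (ι-⋆ 1# a n) (*-identityˡ (a n))

    ⋆-identityʳ : ∀ a → a ⋆ δ ≋ a
    ⋆-identityʳ a n = trans (⋆-comm a δ n) (⋆-identityˡ a n)

    ⋆-assoc : ∀ a b c → (a ⋆ b) ⋆ c ≋ a ⋆ (b ⋆ c)
    ⋆-assoc a b c zero = +-congʳ (begin
      (a 0 * b 0 + 0#) * c 0    ≈⟨ *-congʳ (+-identityʳ _) ⟩
      (a 0 * b 0) * c 0         ≈⟨ *-assoc _ _ _ ⟩
      a 0 * (b 0 * c 0)         ≈⟨ *-congˡ (+-identityʳ _) ⟨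
      a 0 * (b 0 * c 0 + 0#)    ∎)
    ⋆-assoc a b c (suc n) = begin
      ∂ ((a ⋆ b) ⋆ c) n
        ≈⟨ ∂-⋆ (a ⋆ b) c n ⟩
      (∂ (a ⋆ b) ⋆ c) n + ((a ⋆ b) ⋆ ∂ c) n
        ≈⟨ +-congʳ (trans (⋆-cong {b = c} (∂-⋆ a b) (λ _ → refl) n) (⋆-distribʳ-⊞ c (∂ a ⋆ b) (a ⋆ ∂ b) n)) ⟩
      ((∂ a ⋆ b) ⋆ c) n + ((a ⋆ ∂ b) ⋆ c) n + ((a ⋆ b) ⋆ ∂ c) n
        ≈⟨ +-cong (+-cong (⋆-assoc (∂ a) b c n) (⋆-assoc a (∂ b) c n)) (⋆-assoc a b (∂ c) n) ⟩
      (∂ a ⋆ (b ⋆ c)) n + (a ⋆ (∂ b ⋆ c)) n + (a ⋆ (b ⋆ ∂ c)) n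
        ≈⟨ +-assoc _ _ _ ⟩
      (∂ a ⋆ (b ⋆ c)) n + ((a ⋆ (∂ b ⋆ c)) n + (a ⋆ (b ⋆ ∂ c)) n)
        ≈⟨ +-congˡ (⋆-distribˡ-⊞ a (∂ b ⋆ c) (b ⋆ ∂ c) n) ⟨
      (∂ a ⋆ (b ⋆ c)) n + (a ⋆ (∂ b ⋆ c ⊞ b ⋆ ∂ c)) n
        ≈⟨ +-congˡ (⋆-cong {a = a} (λ _ → refl) (∂-⋆ b c) n) ⟨
      (∂ a ⋆ (b ⋆ c)) n + (a ⋆ ∂ (b ⋆ c)) n
        ≈⟨ ∂-⋆ a (b ⋆ c) n ⟨
      ∂ (a ⋆ (b ⋆ c)) n
        ∎

    euler-⋆ : ∀ a b → euler (a ⋆ b) ≋ euler a ⋆ b ⊞ a ⋆ euler b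
    euler-⋆ a b n = begin
      n • ∑ n (λ k → (n C k) • X k)
        ≈⟨ •-distrib-∑ n n _ ⟩
      ∑ n (λ k → n • ((n C k) • X k))
        ≈⟨ ∑-cong n split ⟩
      ∑ n (λ k → (n C k) • ((k • a k) * b (n ∸ k)) + (n C k) • (a k * ((n ∸ k) • b (n ∸ k))))
        ≈⟨ ∑-distrib-+ n _ _ ⟩
      (euler a ⋆ b) n + (a ⋆ euler b) n
        ∎
      where
      X : ℕ → Carrier
      X k = a k * b (n ∸ k)
      split : ∀ k → k ≤ n → n • ((n C k) • X k)
                            ≈ (n C k) • ((k • a k) * b (n ∸ k)) + (n C k) • (a k * ((n ∸ k) • b (n ∸ k)))
      split k k≤n = begin
        n • ((n C k) • X k)                             ≈⟨ •-comm n (n C k) (X k) ⟩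
        (n C k) • (n • X k)                             ≡⟨ ≡.cong (λ m → (n C k) • (m • X k)) (m+[n∸m]≡n k≤n) ⟨
        (n C k) • ((k +ℕ (n ∸ k)) • X k)                ≈⟨ •-congʳ (n C k) (•-homo-+ k (n ∸ k) (X k)) ⟩
        (n C k) • (k • X k + (n ∸ k) • X k)             ≈⟨ •-distrib-+ (n C k) _ _ ⟩
        (n C k) • (k • X k) + (n C k) • ((n ∸ k) • X k)
          ≈⟨ +-cong (•-congʳ (n C k) (•-*-assoc k (a k) _)) (•-congʳ (n C k) (*-•-comm (n ∸ k) (a k) _)) ⟨
        (n C k) • ((k • a k) * b (n ∸ k)) + (n C k) • (a k * ((n ∸ k) • b (n ∸ k)))
          ∎

  egf : CommutativeRing c ℓ
  egf = record
    { Carrier = Seq ; _≈_ = _≋_ ; _+_ = _⊞_ ; _*_ = _⋆_ ; -_ = λ a n → - a n ; 0# = 𝟘 ; 1# = δ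
    ; isCommutativeRing = record
      { isRing = record
        { +-isAbelianGroup = Pointwise.isAbelianGroup ℕ +-isAbelianGroup
        ; *-cong           = ⋆-cong
        ; *-assoc          = ⋆-assoc
        ; *-identity       = ⋆-identityˡ , ⋆-identityʳ
        ; distrib          = ⋆-distribˡ-⊞ , ⋆-distribʳ-⊞
        }
      ; *-comm = ⋆-comm
      }
    }

  module EGF = CommutativeRing egf
  open RingProperties EGF.ring using () renaming (+-cancelˡ to ⊞-cancelˡ)

  module _ where
    open SetoidReasoning EGF.setoid
    open NatSolver EGF.commutativeSemiring using (solve; _:=_; _:+_; _:*_)

    ⊙-⋆-assoc : ∀ r a b → (r ⊙ a) ⋆ b ≋ r ⊙ (a ⋆ b)
    ⊙-⋆-assoc r a b = begin
      (r ⊙ a) ⋆ b      ≈⟨ EGF.*-congʳ {b} (ι-⋆ r a) ⟨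
      (ι r ⋆ a) ⋆ b    ≈⟨ ⋆-assoc (ι r) a b ⟩
      ι r ⋆ (a ⋆ b)    ≈⟨ ι-⋆ r (a ⋆ b) ⟩
      r ⊙ (a ⋆ b)      ∎

    ⋆-⊙-comm : ∀ r a b → a ⋆ (r ⊙ b) ≋ r ⊙ (a ⋆ b)
    ⋆-⊙-comm r a b = begin
      a ⋆ (r ⊙ b)      ≈⟨ ⋆-comm a (r ⊙ b) ⟩
      (r ⊙ b) ⋆ a      ≈⟨ ⊙-⋆-assoc r b a ⟩
      r ⊙ (b ⋆ a)      ≈⟨ (λ n → *-congˡ (⋆-comm b a n)) ⟩
      r ⊙ (a ⋆ b)      ∎

    ∂[]-⋆ : ∀ r a b → ∂[ r ] (a ⋆ b) ≋ ∂[ r ] a ⋆ b ⊞ a ⋆ ∂[ r ] b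
    ∂[]-⋆ r a b = begin
      ∂ (a ⋆ b) ⊞ r ⊙ euler (a ⋆ b)
        ≈⟨ EGF.+-cong (∂-⋆ a b) (EGF.trans (λ n → *-congˡ (euler-⋆ a b n)) (EGF.sym (ι-⋆ r _))) ⟩
      (∂ a ⋆ b ⊞ a ⋆ ∂ b) ⊞ ι r ⋆ (euler a ⋆ b ⊞ a ⋆ euler b)
        ≈⟨ solve 7 (λ ρ a b a′ b′ ea eb →
             (a′ :* b :+ a :* b′) :+ ρ :* (ea :* b :+ a :* eb) := (a′ :+ ρ :* ea) :* b :+ a :* (b′ :+ ρ :* eb))
             EGF.refl (ι r) a b (∂ a) (∂ b) (euler a) (euler b) ⟩
      (∂ a ⊞ ι r ⋆ euler a) ⋆ b ⊞ a ⋆ (∂ b ⊞ ι r ⋆ euler b)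
        ≈⟨ EGF.+-cong (EGF.*-congʳ {b} (EGF.+-congˡ {∂ a} (ι-⋆ r (euler a))))
                      (EGF.*-congˡ {a} (EGF.+-congˡ {∂ b} (ι-⋆ r (euler b)))) ⟩
      ∂[ r ] a ⋆ b ⊞ a ⋆ ∂[ r ] b
        ∎

  -- Reciprocals of 2 - e

  -- f ⋆ (2δ - e) ≋ δ, with the subtraction moved across
  InverseOfTwoMinus : Seq → Seq → Set ℓ
  InverseOfTwoMinus f e = f ⋆ e ⊞ δ ≋ f ⊞ f

  module _ where
    open SetoidReasoning setoid

    egfInvTable-stable : ∀ e {n i} → i ≤ n → egfInvTable R e n i ≡ egfInv R e i
    egfInvTable-stable e {zero} z≤n = ≡.refl
    egfInvTable-stable e {suc n} {i} i≤1+n with m≤n⇒m<n∨m≡n i≤1+n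
    ... | inj₂ ≡.refl = ≡.refl
    ... | inj₁ i<1+n with i ≤? n
    ...   | yes i≤n = egfInvTable-stable e i≤n
    ...   | no  i≰n = ⊥-elim (i≰n (s≤s⁻¹ i<1+n))

    egfInv-suc : ∀ e n → egfInv R e (suc n) ≈ ∑ n (λ j → (suc n C j) • (e (suc n ∸ j) * egfInv R e j))
    egfInv-suc e n with suc n ≤? n
    ... | yes 1+n≤n = ⊥-elim (1+n≰n 1+n≤n)
    ... | no  _     = ∑-cong n (λ j j≤n → •-congʳ (suc n C j) (*-congˡ (reflexive (egfInvTable-stable e j≤n))))

    egfInv-inverseOfTwoMinus : ∀ e → e 0 ≈ 1# → InverseOfTwoMinus (egfInv R e) e
    egfInv-inverseOfTwoMinus e e₀≈1 zero    = +-congʳ (trans (+-identityʳ _) (trans (*-identityˡ _) e₀≈1))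
    egfInv-inverseOfTwoMinus e e₀≈1 (suc n) = begin
      (∑ n (λ j → (suc n C j) • (f j * e (suc n ∸ j))) + last) + 0#
        ≈⟨ +-identityʳ _ ⟩
      ∑ n (λ j → (suc n C j) • (f j * e (suc n ∸ j))) + last
        ≈⟨ +-cong (∑-cong n (λ j _ → •-congʳ (suc n C j) (*-comm (f j) _))) last≈fₙ₊₁ ⟩
      ∑ n (λ j → (suc n C j) • (e (suc n ∸ j) * f j)) + f (suc n)
        ≈⟨ +-congʳ (egfInv-suc e n) ⟨
      f (suc n) + f (suc n)
        ∎
      where
      f : Seq
      f = egfInv R e
      last : Carrier
      last = (suc n C suc n) • (f (suc n) * e (n ∸ n))
      last≈fₙ₊₁ : last ≈ f (suc n)
      last≈fₙ₊₁ = begin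
        last                  ≡⟨ ≡.cong₂ (λ m i → m • (f (suc n) * e i)) (nCn≡1 (suc n)) (n∸n≡0 n) ⟩
        f (suc n) * e 0 + 0#  ≈⟨ +-identityʳ _ ⟩
        f (suc n) * e 0       ≈⟨ *-congˡ e₀≈1 ⟩
        f (suc n) * 1#        ≈⟨ *-identityʳ _ ⟩
        f (suc n)             ∎

  module _ where
    open SetoidReasoning EGF.setoid
    open NatSolver EGF.commutativeSemiring using (solve; _:=_; _:+_; _:*_; con)

    inverseOfTwoMinus-unique : ∀ {e f g} → InverseOfTwoMinus f e → InverseOfTwoMinus g e → f ≋ g
    inverseOfTwoMinus-unique {e} {f} {g} f-inv g-inv = EGF.sym (⊞-cancelˡ (f ⋆ e ⋆ g) g f (begin
      f ⋆ e ⋆ g ⊞ g      ≈⟨ solve 3 (λ f e g → f :* e :* g :+ g := (f :* e :+ con 1) :* g) EGF.refl f e g ⟩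
      (f ⋆ e ⊞ δ) ⋆ g    ≈⟨ EGF.*-congʳ {g} f-inv ⟩
      (f ⊞ f) ⋆ g        ≈⟨ solve 2 (λ f g → (f :+ f) :* g := (g :+ g) :* f) EGF.refl f g ⟩
      (g ⊞ g) ⋆ f        ≈⟨ EGF.*-congʳ {f} g-inv ⟨
      (g ⋆ e ⊞ δ) ⋆ f    ≈⟨ solve 3 (λ f e g → (g :* e :+ con 1) :* f := f :* e :* g :+ f) EGF.refl f e g ⟩
      f ⋆ e ⋆ g ⊞ f      ∎))

    inverseOfTwoMinus-respʳ : ∀ {e e′ f} → e ≋ e′ → InverseOfTwoMinus f e → InverseOfTwoMinus f e′
    inverseOfTwoMinus-respʳ {f = f} e≋e′ f-inv = EGF.trans (EGF.+-congʳ (EGF.*-congˡ {f} (EGF.sym e≋e′))) f-inv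

    ∂-inverseOfTwoMinus : ∀ {e f} → InverseOfTwoMinus f e → ∂ f ≋ f ⋆ f ⋆ ∂ e
    ∂-inverseOfTwoMinus {e} {f} f-inv = ⊞-cancelˡ (∂ f ⋆ f ⋆ e) (∂ f) (f ⋆ f ⋆ ∂ e) (begin
      ∂ f ⋆ f ⋆ e ⊞ ∂ f
        ≈⟨ solve 3 (λ f′ f e → f′ :* f :* e :+ f′ := f′ :* (f :* e :+ con 1)) EGF.refl (∂ f) f e ⟩
      ∂ f ⋆ (f ⋆ e ⊞ δ)
        ≈⟨ EGF.*-congˡ {∂ f} f-inv ⟩
      ∂ f ⋆ (f ⊞ f)
        ≈⟨ solve 2 (λ f′ f → f′ :* (f :+ f) := f :* (f′ :+ f′)) EGF.refl (∂ f) f ⟩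
      f ⋆ (∂ f ⊞ ∂ f)
        ≈⟨ EGF.*-congˡ {f} ∂f-inv ⟨
      f ⋆ (∂ f ⋆ e ⊞ f ⋆ ∂ e)
        ≈⟨ solve 4 (λ f′ f e e′ → f :* (f′ :* e :+ f :* e′) := f′ :* f :* e :+ f :* f :* e′) EGF.refl (∂ f) f e (∂ e) ⟩
      ∂ f ⋆ f ⋆ e ⊞ f ⋆ f ⋆ ∂ e
        ∎)
      where
      ∂f-inv : ∂ f ⋆ e ⊞ f ⋆ ∂ e ≋ ∂ f ⊞ ∂ f
      ∂f-inv n = trans (sym (∂-⋆ f e n)) (trans (sym (+-identityʳ _)) (f-inv (suc n)))

  -- Sequences of binomial type

  module BinomialType (F : Carrier → Seq) (μ : Carrier)
    (F-cong : ∀ {y z} → y ≈ z → F y ≋ F z)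
    (F-zero : ∀ y → F y 0 ≈ 1#)
    (∂-F : ∀ y → ∂ (F y) ≋ y ⊙ F (y - μ)) where
    open SetoidReasoning setoid

    F-⋆ : ∀ y z → F y ⋆ F z ≋ F (y + z)
    F-⋆ y z zero = begin
      F y 0 * F z 0 + 0#    ≈⟨ +-identityʳ _ ⟩
      F y 0 * F z 0         ≈⟨ *-cong (F-zero y) (F-zero z) ⟩
      1# * 1#               ≈⟨ *-identityˡ 1# ⟩
      1#                    ≈⟨ F-zero (y + z) ⟨
      F (y + z) 0           ∎
    F-⋆ y z (suc n) = begin
      ∂ (F y ⋆ F z) n
        ≈⟨ ∂-⋆ (F y) (F z) n ⟩
      (∂ (F y) ⋆ F z) n + (F y ⋆ ∂ (F z)) n
        ≈⟨ +-cong (⋆-cong {b = F z} (∂-F y) (λ _ → refl) n) (⋆-cong {a = F y} (λ _ → refl) (∂-F z) n) ⟩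
      ((y ⊙ F (y - μ)) ⋆ F z) n + (F y ⋆ (z ⊙ F (z - μ))) n
        ≈⟨ +-cong (⊙-⋆-assoc y (F (y - μ)) (F z) n) (⋆-⊙-comm z (F y) (F (z - μ)) n) ⟩
      y * (F (y - μ) ⋆ F z) n + z * (F y ⋆ F (z - μ)) n
        ≈⟨ +-cong (*-congˡ (F-⋆ (y - μ) z n)) (*-congˡ (F-⋆ y (z - μ) n)) ⟩
      y * F (y - μ + z) n + z * F (y + (z - μ)) n
        ≈⟨ +-cong (*-congˡ (F-cong (xy∙z≈xz∙y y (- μ) z) n)) (*-congˡ (F-cong (sym (+-assoc y z (- μ))) n)) ⟩
      y * F (y + z - μ) n + z * F (y + z - μ) n
        ≈⟨ distribʳ _ y z ⟨
      (y + z) * F (y + z - μ) n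
        ≈⟨ ∂-F (y + z) n ⟨
      F (y + z) (suc n)
        ∎

  powers : Carrier → Seq
  powers y n = _^_ R y n

  module _ where
    open SetoidReasoning setoid

    powers-cong : ∀ {y z} → y ≈ z → powers y ≋ powers z
    powers-cong y≈z zero    = refl
    powers-cong y≈z (suc n) = *-cong y≈z (powers-cong y≈z n)

    powers-⋆ : ∀ y z → powers y ⋆ powers z ≋ powers (y + z)
    powers-⋆ = BinomialType.F-⋆ powers 0# powers-cong (λ _ → refl)
      (λ y n → *-congˡ (powers-cong (sym (trans (+-congˡ -0#≈0#) (+-identityʳ y))) n))

    powers-one : powers 1# ≋ (λ _ → 1#)
    powers-one zero    = refl
    powers-one (suc n) = trans (*-identityˡ _) (powers-one n)

    ^-homo-+ : ∀ r i j → _^_ R r (i +ℕ j) ≈ _^_ R r i * _^_ R r j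
    ^-homo-+ r zero    j = sym (*-identityˡ _)
    ^-homo-+ r (suc i) j = trans (*-congˡ (^-homo-+ r i j)) (sym (*-assoc r _ _))

    sgn-powers : ∀ r → (λ j → sgn R j * _^_ R r j) ≋ powers (- r)
    sgn-powers r zero    = *-identityˡ 1#
    sgn-powers r (suc j) = begin
      - sgn R j * (r * _^_ R r j)    ≈⟨ -‿distribˡ-* _ _ ⟨
      - (sgn R j * (r * _^_ R r j))  ≈⟨ -‿cong (*-x∙yz≈y∙xz _ _ _) ⟩
      - (r * (sgn R j * _^_ R r j))  ≈⟨ -‿distribˡ-* _ _ ⟩
      - r * (sgn R j * _^_ R r j)    ≈⟨ *-congˡ (sgn-powers r j) ⟩
      - r * powers (- r) j           ∎

  -- Stirling numbers and the substitution t ↦ log(1 + λ′t)/λ′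

  module _ where
    open SetoidReasoning setoid

    S₁-suc-suc : ∀ k m → S₁ R (suc k) (suc m) + k • S₁ R k (suc m) ≈ S₁ R k m
    S₁-suc-suc k m = //-rightDividesˡ (k • S₁ R k (suc m)) (S₁ R k m)

    S₁-vanish : ∀ {k m} → k < m → S₁ R k m ≈ 0#
    S₁-vanish {zero}  {suc m} _         = refl
    S₁-vanish {suc k} {suc m} (s≤s k<m) = begin
      S₁ R k m - k • S₁ R k (suc m)
        ≈⟨ +-cong (S₁-vanish k<m) (-‿cong (trans (•-congʳ k (S₁-vanish (m<n⇒m<1+n k<m))) (•-zeroʳ k))) ⟩
      0# - 0#
        ≈⟨ -‿inverseʳ 0# ⟩
      0#
        ∎

    •-S₁-zero : ∀ k → k • S₁ R k 0 ≈ 0#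
    •-S₁-zero zero    = refl
    •-S₁-zero (suc k) = •-zeroʳ (suc k)

  module _ (λ′ : Carrier) where

    -- the coefficients of A(log(1 + λ′t)/λ′), given those of A(t)
    stirling : Seq → Seq
    stirling a k = ∑ k (λ m → (_^_ R λ′ (k ∸ m) * S₁ R k m) * a m)

    module _ where
      open SetoidReasoning setoid

      dfall-cong : ∀ {y z} → y ≈ z → dfall R λ′ y ≋ dfall R λ′ z
      dfall-cong y≈z zero    = refl
      dfall-cong y≈z (suc n) = *-cong (dfall-cong y≈z n) (+-congʳ y≈z)

      ∂-dfall : ∀ y → ∂ (dfall R λ′ y) ≋ y ⊙ dfall R λ′ (y - λ′)
      ∂-dfall y zero = begin
        1# * (y - 0#)   ≈⟨ *-identityˡ _ ⟩
        y - 0#          ≈⟨ +-congˡ -0#≈0# ⟩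
        y + 0#          ≈⟨ +-identityʳ y ⟩
        y               ≈⟨ *-identityʳ y ⟨
        y * 1#          ∎
      ∂-dfall y (suc n) = begin
        dfall R λ′ y (suc n) * (y - (λ′ + n • λ′))
          ≈⟨ *-cong (∂-dfall y n) (trans (+-congˡ (sym (-‿+-comm λ′ (n • λ′)))) (sym (+-assoc y (- λ′) (- (n • λ′))))) ⟩
        (y * dfall R λ′ (y - λ′) n) * ((y - λ′) - n • λ′)
          ≈⟨ *-assoc _ _ _ ⟩
        y * (dfall R λ′ (y - λ′) n * ((y - λ′) - n • λ′))
          ∎

      dfall-⋆ : ∀ y z → dfall R λ′ y ⋆ dfall R λ′ z ≋ dfall R λ′ (y + z)
      dfall-⋆ = BinomialType.F-⋆ (dfall R λ′) λ′ dfall-cong (λ _ → refl) ∂-dfall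

      ∂[]-dfall : ∀ y → ∂[ λ′ ] (dfall R λ′ y) ≋ y ⊙ dfall R λ′ y
      ∂[]-dfall y k = begin
        D k * (y - k • λ′) + λ′ * (k • D k)
          ≈⟨ +-cong (x[y-z]≈xy-xz (D k) y (k • λ′)) λ′[k•D]≈D[k•λ′] ⟩
        (D k * y - D k * (k • λ′)) + D k * (k • λ′)
          ≈⟨ //-rightDividesˡ (D k * (k • λ′)) (D k * y) ⟩
        D k * y
          ≈⟨ *-comm (D k) y ⟩
        y * D k
          ∎
        where
        D : Seq
        D = dfall R λ′ y
        λ′[k•D]≈D[k•λ′] : λ′ * (k • D k) ≈ D k * (k • λ′)
        λ′[k•D]≈D[k•λ′] = begin
          λ′ * (k • D k)  ≈⟨ *-•-comm k λ′ (D k) ⟩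
          k • (λ′ * D k)  ≈⟨ •-congʳ k (*-comm λ′ (D k)) ⟩
          k • (D k * λ′)  ≈⟨ *-•-comm k (D k) λ′ ⟨
          D k * (k • λ′)  ∎

      ∂[]-determines-suc : ∀ a b k → a k ≈ b k → ∂[ λ′ ] a k ≈ ∂[ λ′ ] b k → a (suc k) ≈ b (suc k)
      ∂[]-determines-suc a b k aₖ≈bₖ ∂a≈∂b =
        +-cancelʳ (λ′ * (k • a k)) _ _ (trans ∂a≈∂b (+-congˡ (*-congˡ (•-congʳ k (sym aₖ≈bₖ)))))

      stirling-cong : ∀ {a b} → a ≋ b → stirling a ≋ stirling b
      stirling-cong a≋b k = ∑-cong k (λ m _ → *-congˡ (a≋b m))

      stirling-⊞ : ∀ a b → stirling (a ⊞ b) ≋ stirling a ⊞ stirling b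
      stirling-⊞ a b k = trans (∑-cong k (λ m _ → distribˡ _ (a m) (b m))) (∑-distrib-+ k _ _)

      stirling-⊙ : ∀ r a → stirling (r ⊙ a) ≋ r ⊙ stirling a
      stirling-⊙ r a k = trans (∑-cong k (λ m _ → *-x∙yz≈y∙xz _ r (a m))) (sym (*-distribˡ-∑ r k _))

      stirling-zero : ∀ a → stirling a 0 ≈ a 0
      stirling-zero a = trans (*-congʳ (*-identityˡ 1#)) (*-identityˡ (a 0))

      stirling-suc : ∀ a k → stirling a (suc k) ≈ ∑ k (λ m → (_^_ R λ′ (k ∸ m) * S₁ R (suc k) (suc m)) * a (suc m))
      stirling-suc a k = trans (∑-shift k _) (trans (+-congʳ (trans (*-congʳ (zeroʳ _)) (zeroˡ _))) (+-identityˡ _))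

      stirling-δ : stirling δ ≋ δ
      stirling-δ zero    = stirling-zero δ
      stirling-δ (suc k) = trans (stirling-suc δ k) (trans (∑-cong k (λ m _ → zeroʳ _)) (∑-zero k))

      λ′*stirling : ∀ a k → λ′ * stirling a k ≈ (_^_ R λ′ (suc k) * S₁ R k 0) * a 0
                                                + ∑ k (λ m → (_^_ R λ′ (k ∸ m) * S₁ R k (suc m)) * a (suc m))
      λ′*stirling a k = begin
        λ′ * stirling a k                                        ≈⟨ *-distribˡ-∑ λ′ k _ ⟩
        ∑ k (λ m → λ′ * ((_^_ R λ′ (k ∸ m) * S₁ R k m) * a m))   ≈⟨ ∑-cong k raise ⟩
        ∑ k g                                                    ≈⟨ ∑-shift-vanishing k g g-last ⟩
        g 0 + ∑ k (λ m → g (suc m))                              ∎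
        where
        g : ℕ → Carrier
        g m = (_^_ R λ′ (suc k ∸ m) * S₁ R k m) * a m
        raise : ∀ m → m ≤ k → λ′ * ((_^_ R λ′ (k ∸ m) * S₁ R k m) * a m) ≈ g m
        raise m m≤k = begin
          λ′ * ((_^_ R λ′ (k ∸ m) * S₁ R k m) * a m)  ≈⟨ *-assoc λ′ _ _ ⟨
          (λ′ * (_^_ R λ′ (k ∸ m) * S₁ R k m)) * a m  ≈⟨ *-congʳ (*-assoc λ′ _ _) ⟨
          (_^_ R λ′ (suc (k ∸ m)) * S₁ R k m) * a m   ≡⟨ ≡.cong (λ i → (_^_ R λ′ i * S₁ R k m) * a m) (+-∸-assoc 1 m≤k) ⟨
          g m                                         ∎
        g-last : g (suc k) ≈ 0#
        g-last = trans (*-congʳ (trans (*-congˡ (S₁-vanish (n<1+n k))) (zeroʳ _))) (zeroˡ _)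

      -- the chain rule for the substitution, whose derivative is 1/(1 + λ′t)
      ∂[]-stirling : ∀ a → ∂[ λ′ ] (stirling a) ≋ stirling (∂ a)
      ∂[]-stirling a k = begin
        stirling a (suc k) + λ′ * (k • stirling a k)
          ≈⟨ +-cong (stirling-suc a k) (trans (*-•-comm k λ′ _) (•-congʳ k (λ′*stirling a k))) ⟩
        ∑ k v + k • (head + ∑ k u)
          ≈⟨ +-congˡ (trans (•-distrib-+ k _ _) (+-cong k•head≈0 (•-distrib-∑ k k u))) ⟩
        ∑ k v + (0# + ∑ k (λ m → k • u m))
          ≈⟨ +-congˡ (+-identityˡ _) ⟩
        ∑ k v + ∑ k (λ m → k • u m)
          ≈⟨ ∑-distrib-+ k _ _ ⟨
        ∑ k (λ m → v m + k • u m)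
          ≈⟨ ∑-cong k (λ m _ → recombine m) ⟩
        stirling (∂ a) k
          ∎
        where
        P : ℕ → Carrier
        P m = _^_ R λ′ (k ∸ m)
        v u : ℕ → Carrier
        v m = (P m * S₁ R (suc k) (suc m)) * a (suc m)
        u m = (P m * S₁ R k (suc m)) * a (suc m)
        head : Carrier
        head = (_^_ R λ′ (suc k) * S₁ R k 0) * a 0
        k•head≈0 : k • head ≈ 0#
        k•head≈0 = trans (•-inward k _ _ _) (trans (*-congʳ (trans (*-congˡ (•-S₁-zero k)) (zeroʳ _))) (zeroˡ _))
        recombine : ∀ m → v m + k • u m ≈ (P m * S₁ R k m) * a (suc m)
        recombine m = begin
          (P m * S₁ R (suc k) (suc m)) * a (suc m) + k • ((P m * S₁ R k (suc m)) * a (suc m))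
            ≈⟨ +-congˡ (•-inward k _ _ _) ⟩
          (P m * S₁ R (suc k) (suc m)) * a (suc m) + (P m * (k • S₁ R k (suc m))) * a (suc m)
            ≈⟨ distribʳ _ _ _ ⟨
          (P m * S₁ R (suc k) (suc m) + P m * (k • S₁ R k (suc m))) * a (suc m)
            ≈⟨ *-congʳ (distribˡ _ _ _) ⟨
          (P m * (S₁ R (suc k) (suc m) + k • S₁ R k (suc m))) * a (suc m)
            ≈⟨ *-congʳ (*-congˡ (S₁-suc-suc k m)) ⟩
          (P m * S₁ R k m) * a (suc m)
            ∎

      stirling-⋆ : ∀ a b → stirling (a ⋆ b) ≋ stirling a ⋆ stirling b
      stirling-⋆ a b zero    = trans (stirling-zero (a ⋆ b)) (+-congʳ (sym (*-cong (stirling-zero a) (stirling-zero b))))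
      stirling-⋆ a b (suc k) = ∂[]-determines-suc (stirling (a ⋆ b)) (A ⋆ B) k (stirling-⋆ a b k) (begin
        ∂[ λ′ ] (stirling (a ⋆ b)) k
          ≈⟨ ∂[]-stirling (a ⋆ b) k ⟩
        stirling (∂ (a ⋆ b)) k
          ≈⟨ trans (stirling-cong (∂-⋆ a b) k) (stirling-⊞ (∂ a ⋆ b) (a ⋆ ∂ b) k) ⟩
        stirling (∂ a ⋆ b) k + stirling (a ⋆ ∂ b) k
          ≈⟨ +-cong (stirling-⋆ (∂ a) b k) (stirling-⋆ a (∂ b) k) ⟩
        (stirling (∂ a) ⋆ B) k + (A ⋆ stirling (∂ b)) k
          ≈⟨ +-cong (⋆-cong {b = B} (∂[]-stirling a) (λ _ → refl) k) (⋆-cong {a = A} (λ _ → refl) (∂[]-stirling b) k) ⟨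
        (∂[ λ′ ] A ⋆ B) k + (A ⋆ ∂[ λ′ ] B) k
          ≈⟨ ∂[]-⋆ λ′ A B k ⟨
        ∂[ λ′ ] (A ⋆ B) k
          ∎)
        where
        A B : Seq
        A = stirling a
        B = stirling b

      stirling-powers : ∀ y → stirling (powers y) ≋ dfall R λ′ y
      stirling-powers y zero    = stirling-zero (powers y)
      stirling-powers y (suc k) = ∂[]-determines-suc (stirling (powers y)) (dfall R λ′ y) k (stirling-powers y k) (begin
        ∂[ λ′ ] (stirling (powers y)) k   ≈⟨ ∂[]-stirling (powers y) k ⟩
        stirling (y ⊙ powers y) k         ≈⟨ stirling-⊙ y (powers y) k ⟩
        y * stirling (powers y) k         ≈⟨ *-congˡ (stirling-powers y k) ⟩
        y * dfall R λ′ y k                ≈⟨ ∂[]-dfall y k ⟨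
        ∂[ λ′ ] (dfall R λ′ y) k          ∎)

    module _ where
      open SetoidReasoning EGF.setoid

      stirling-inverseOfTwoMinus : ∀ {e f} → InverseOfTwoMinus f e → InverseOfTwoMinus (stirling f) (stirling e)
      stirling-inverseOfTwoMinus {e} {f} f-inv = begin
        stirling f ⋆ stirling e ⊞ δ      ≈⟨ EGF.+-cong (stirling-⋆ f e) stirling-δ ⟨
        stirling (f ⋆ e) ⊞ stirling δ    ≈⟨ stirling-⊞ (f ⋆ e) δ ⟨
        stirling (f ⋆ e ⊞ δ)             ≈⟨ stirling-cong f-inv ⟩
        stirling (f ⊞ f)                 ≈⟨ stirling-⊞ f f ⟩
        stirling f ⊞ stirling f          ∎

      degBell-inverseOfTwoMinus : InverseOfTwoMinus (degBell R λ′) (dfall R λ′ 1#)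
      degBell-inverseOfTwoMinus = egfInv-inverseOfTwoMinus (dfall R λ′ 1#) refl

      stirling-ordBell : stirling (ordBell R) ≋ degBell R λ′
      stirling-ordBell = inverseOfTwoMinus-unique {dfall R λ′ 1#} stirling-ordBell-inverse degBell-inverseOfTwoMinus
        where
        stirling-ordBell-inverse : InverseOfTwoMinus (stirling (ordBell R)) (dfall R λ′ 1#)
        stirling-ordBell-inverse = inverseOfTwoMinus-respʳ {stirling (λ _ → 1#)}
          (EGF.trans (stirling-cong (EGF.sym powers-one)) (stirling-powers 1#))
          (stirling-inverseOfTwoMinus (egfInv-inverseOfTwoMinus (λ _ → 1#) refl))

    -- Degenerate ordered Bell polynomials

    module _ (x : Carrier) where
      private
        b : Seq
        b = degBell R λ′
        D : Carrier → Seq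
        D = dfall R λ′
        y : Carrier
        y = x - λ′

      module _ where
        open SetoidReasoning EGF.setoid
        open NatSolver EGF.commutativeSemiring using (solve; _:=_; _:+_; _:*_; con)

        ∂-dfall-one-⋆ : ∂ (D 1#) ⋆ D x ≋ D 1# ⋆ D y
        ∂-dfall-one-⋆ = begin
          ∂ (D 1#) ⋆ D x              ≈⟨ EGF.*-congʳ {D x} (∂-dfall 1#) ⟩
          (1# ⊙ D (1# - λ′)) ⋆ D x    ≈⟨ ⊙-⋆-assoc 1# (D (1# - λ′)) (D x) ⟩
          1# ⊙ (D (1# - λ′) ⋆ D x)    ≈⟨ (λ n → *-identityˡ _) ⟩
          D (1# - λ′) ⋆ D x           ≈⟨ dfall-⋆ (1# - λ′) x ⟩
          D (1# - λ′ + x)             ≈⟨ dfall-cong (xy∙z≈x∙zy 1# (- λ′) x) ⟩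
          D (1# + y)                  ≈⟨ dfall-⋆ 1# y ⟨
          D 1# ⋆ D y                  ∎

        ∂-degBellPoly : ∂ (b ⋆ D x) ⊞ b ⋆ D y ≋ b ⋆ (b ⋆ D y) ⊞ b ⋆ (b ⋆ D y) ⊞ x ⊙ (b ⋆ D y)
        ∂-degBellPoly = begin
          ∂ (b ⋆ D x) ⊞ b ⋆ D y
            ≈⟨ EGF.+-congʳ (∂-⋆ b (D x)) ⟩
          ∂ b ⋆ D x ⊞ b ⋆ ∂ (D x) ⊞ b ⋆ D y
            ≈⟨ EGF.+-congʳ (EGF.+-cong (EGF.*-congʳ {D x} (∂-inverseOfTwoMinus {D 1#} degBell-inverseOfTwoMinus)) b⋆∂Dx) ⟩
          b ⋆ b ⋆ ∂ (D 1#) ⋆ D x ⊞ x ⊙ (b ⋆ D y) ⊞ b ⋆ D y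
            ≈⟨ solve 5 (λ b e d g X → b :* b :* e :* d :+ X :+ b :* g := b :* b :* (e :* d) :+ b :* g :+ X)
                 EGF.refl b (∂ (D 1#)) (D x) (D y) (x ⊙ (b ⋆ D y)) ⟩
          b ⋆ b ⋆ (∂ (D 1#) ⋆ D x) ⊞ b ⋆ D y ⊞ x ⊙ (b ⋆ D y)
            ≈⟨ EGF.+-congʳ (EGF.+-congʳ (EGF.*-congˡ {b ⋆ b} ∂-dfall-one-⋆)) ⟩
          b ⋆ b ⋆ (D 1# ⋆ D y) ⊞ b ⋆ D y ⊞ x ⊙ (b ⋆ D y)
            ≈⟨ solve 4 (λ b d g X → b :* b :* (d :* g) :+ b :* g :+ X := (b :* d :+ con 1) :* (b :* g) :+ X)
                 EGF.refl b (D 1#) (D y) (x ⊙ (b ⋆ D y)) ⟩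
          (b ⋆ D 1# ⊞ δ) ⋆ (b ⋆ D y) ⊞ x ⊙ (b ⋆ D y)
            ≈⟨ EGF.+-congʳ (EGF.*-congʳ {b ⋆ D y} degBell-inverseOfTwoMinus) ⟩
          (b ⊞ b) ⋆ (b ⋆ D y) ⊞ x ⊙ (b ⋆ D y)
            ≈⟨ EGF.+-congʳ (⋆-distribʳ-⊞ (b ⋆ D y) b b) ⟩
          b ⋆ (b ⋆ D y) ⊞ b ⋆ (b ⋆ D y) ⊞ x ⊙ (b ⋆ D y)
            ∎
          where
          b⋆∂Dx : b ⋆ ∂ (D x) ≋ x ⊙ (b ⋆ D y)
          b⋆∂Dx = EGF.trans (EGF.*-congˡ {b} (∂-dfall x)) (⋆-⊙-comm x b (D y))

        stirling-ordBellPoly : stirling (powers (- λ′) ⋆ (ordBell R ⋆ powers x)) ≋ b ⋆ D y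
        stirling-ordBellPoly = begin
          stirling (powers (- λ′) ⋆ (ordBell R ⋆ powers x))
            ≈⟨ stirling-cong (solve 3 (λ p o q → p :* (o :* q) := o :* (p :* q)) EGF.refl (powers (- λ′)) (ordBell R) (powers x)) ⟩
          stirling (ordBell R ⋆ (powers (- λ′) ⋆ powers x))
            ≈⟨ stirling-cong (EGF.*-congˡ {ordBell R} (powers-⋆ (- λ′) x)) ⟩
          stirling (ordBell R ⋆ powers (- λ′ + x))
            ≈⟨ stirling-⋆ (ordBell R) (powers (- λ′ + x)) ⟩
          stirling (ordBell R) ⋆ stirling (powers (- λ′ + x))
            ≈⟨ ⋆-cong stirling-ordBell (stirling-powers (- λ′ + x)) ⟩
          b ⋆ D (- λ′ + x)
            ≈⟨ EGF.*-congˡ {b} (dfall-cong (+-comm (- λ′) x)) ⟩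
          b ⋆ D y
            ∎

      module _ where
        open SetoidReasoning setoid
        open NatSolver commutativeSemiring using (solve; _:=_; _:*_)

        degBellPoly-recurrence : ∀ n →
          (degBellPoly R λ′ (suc n) x - x * degBellPoly R λ′ n y) + degBellPoly R λ′ n y ≈ 2 • (b ⋆ (b ⋆ D y)) n
        degBellPoly-recurrence n = begin
          (A - x * B) + B          ≈⟨ xy∙z≈xz∙y A (- (x * B)) B ⟩
          (A + B) - x * B          ≈⟨ +-congʳ (∂-degBellPoly n) ⟩
          (P + P + x * B) - x * B  ≈⟨ //-rightDividesʳ (x * B) (P + P) ⟩
          P + P                    ≈⟨ +-congˡ (+-identityʳ P) ⟨
          P + (P + 0#)             ∎
          where
          A B P : Carrier
          A = ∂ (b ⋆ D x) n
          B = (b ⋆ D y) n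
          P = (b ⋆ (b ⋆ D y)) n

        ordBellPoly-expansion : ∀ n → ∑ n (λ k → ∑ k (λ m → ∑ m (λ l → ((n C k) *ℕ (m C l)) •
                                   (_^_ R λ′ ((k ∸ m) +ℕ l) * S₁ R k m * b (n ∸ k) * sgn R l * ordBellPoly R (m ∸ l) x))))
                                 ≈ (b ⋆ (b ⋆ D y)) n
        ordBellPoly-expansion n = begin
          ∑ n (λ k → ∑ k (λ m → ∑ m (λ l → ((n C k) *ℕ (m C l)) •
            (_^_ R λ′ ((k ∸ m) +ℕ l) * S₁ R k m * b (n ∸ k) * sgn R l * O (m ∸ l)))))
            ≈⟨ ∑-cong n (λ k _ → sum-over-m k) ⟩
          (stirling (alt ⋆ O) ⋆ b) n
            ≈⟨ ⋆-comm (stirling (alt ⋆ O)) b n ⟩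
          (b ⋆ stirling (alt ⋆ O)) n
            ≈⟨ ⋆-cong {a = b} (λ _ → refl) (EGF.trans (stirling-cong (⋆-cong {b = O} (sgn-powers λ′) (λ _ → refl)))
                                                     stirling-ordBellPoly) n ⟩
          (b ⋆ (b ⋆ D y)) n
            ∎
          where
          alt O : Seq
          alt l = sgn R l * _^_ R λ′ l
          O j = ordBellPoly R j x
          module _ (k : ℕ) where
            W : Carrier
            W = b (n ∸ k)
            Q : ℕ → Carrier
            Q m = _^_ R λ′ (k ∸ m) * S₁ R k m
            regroup : ∀ m l → ((n C k) *ℕ (m C l)) • (_^_ R λ′ ((k ∸ m) +ℕ l) * S₁ R k m * W * sgn R l * O (m ∸ l))
                              ≈ (n C k) • ((Q m * ((m C l) • (alt l * O (m ∸ l)))) * W)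
            regroup m l = begin
              ((n C k) *ℕ (m C l)) • (_^_ R λ′ ((k ∸ m) +ℕ l) * S₁ R k m * W * sgn R l * O (m ∸ l))
                ≈⟨ •-assoc (n C k) (m C l) _ ⟩
              (n C k) • ((m C l) • (_^_ R λ′ ((k ∸ m) +ℕ l) * S₁ R k m * W * sgn R l * O (m ∸ l)))
                ≈⟨ •-congʳ (n C k) (•-congʳ (m C l) (*-congʳ (*-congʳ (*-congʳ (*-congʳ (^-homo-+ λ′ (k ∸ m) l)))))) ⟩
              (n C k) • ((m C l) • (_^_ R λ′ (k ∸ m) * _^_ R λ′ l * S₁ R k m * W * sgn R l * O (m ∸ l)))
                ≈⟨ •-congʳ (n C k) (•-congʳ (m C l) (solve 6 (λ p q s w σ o → p :* q :* s :* w :* σ :* o := p :* s :* (σ :* q :* o) :* w)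
                     refl (_^_ R λ′ (k ∸ m)) (_^_ R λ′ l) (S₁ R k m) W (sgn R l) (O (m ∸ l)))) ⟩
              (n C k) • ((m C l) • ((Q m * (alt l * O (m ∸ l))) * W))
                ≈⟨ •-congʳ (n C k) (trans (*-congʳ (*-•-comm (m C l) _ _)) (•-*-assoc (m C l) _ W)) ⟨
              (n C k) • ((Q m * ((m C l) • (alt l * O (m ∸ l)))) * W)
                ∎
            sum-over-l : ∀ m → ∑ m (λ l → ((n C k) *ℕ (m C l)) • (_^_ R λ′ ((k ∸ m) +ℕ l) * S₁ R k m * W * sgn R l * O (m ∸ l)))
                               ≈ (n C k) • ((Q m * (alt ⋆ O) m) * W)
            sum-over-l m = begin
              _ ≈⟨ ∑-cong m (λ l _ → regroup m l) ⟩
              ∑ m (λ l → (n C k) • ((Q m * ((m C l) • (alt l * O (m ∸ l)))) * W))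
                ≈⟨ •-distrib-∑ (n C k) m _ ⟨
              (n C k) • ∑ m (λ l → (Q m * ((m C l) • (alt l * O (m ∸ l)))) * W)
                ≈⟨ •-congʳ (n C k) (trans (sym (*-distribʳ-∑ W m _)) (*-congʳ (sym (*-distribˡ-∑ (Q m) m _)))) ⟩
              (n C k) • ((Q m * (alt ⋆ O) m) * W)
                ∎
            sum-over-m : ∑ k (λ m → ∑ m (λ l → ((n C k) *ℕ (m C l)) • (_^_ R λ′ ((k ∸ m) +ℕ l) * S₁ R k m * W * sgn R l * O (m ∸ l))))
                         ≈ (n C k) • (stirling (alt ⋆ O) k * W)
            sum-over-m = begin
              _ ≈⟨ ∑-cong k (λ m _ → sum-over-l m) ⟩
              ∑ k (λ m → (n C k) • ((Q m * (alt ⋆ O) m) * W))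
                ≈⟨ •-distrib-∑ (n C k) k _ ⟨
              (n C k) • ∑ k (λ m → (Q m * (alt ⋆ O) m) * W)
                ≈⟨ •-congʳ (n C k) (*-distribʳ-∑ W k _) ⟨
              (n C k) • (stirling (alt ⋆ O) k * W)
                ∎

theorem7 : ∀ {c ℓ : Level} (R : CommutativeRing c ℓ) →
  let open CommutativeRing R renaming (_+_ to _⊕_) in
  (λ' : Carrier) → ¬ (λ' ≈ 0#) → (x : Carrier) → (n : ℕ) →
    (degBellPoly R λ' (suc n) x - x * degBellPoly R λ' n (x - λ')) ⊕ degBellPoly R λ' n (x - λ')
    ≈ _·_ R 2 (Σ≤ R n (λ k → Σ≤ R k (λ m → Σ≤ R m (λ l →
        _·_ R ((n C k) *ℕ (m C l))
          (_^_ R λ' ((k ∸ m) +ℕ l) * S₁ R k m * degBell R λ' (n ∸ k)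
            * sgn R l * ordBellPoly R (m ∸ l) x)))))
theorem7 R λ′ _ x n =
  trans (degBellPoly-recurrence R λ′ x n) (•-congʳ R 2 (sym (ordBellPoly-expansion R λ′ x n)))
  where open CommutativeRing R
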